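{- The relation $\sqsubset$ on $\mathbb{N}^*$ is well founded, and its minimal elements are exactly the sequences in $0^*$.
   Context: For $v,w\in\mathbb{N}^*$ (finite sequences of natural numbers), $v\sqsubset w$ holds if there are decompositions $v=xyz$ and $w=xiz$ with $x,z\in\mathbb{N}^*$, $i\in\mathbb{N}$ with $i>0$, and $y\in\mathbb{N}^*$ a sequence all of whose entries are strictly smaller than $i$. -}

module Defs where

open import Data.Nat using (ℕ; _<_)
open import Data.List using (List; _++_; [_])
open import Data.List.Relation.Unary.All using (All)
open import Data.Product using (∃-syntax; _×_)
open import Relation.Binary.PropositionalEquality using (_≡_)
open import Relation.Nullary using (¬_)

_⊏_ : List ℕ → List ℕ → Set
v ⊏ w = ∃[ x ] ∃[ y ] ∃[ z ] ∃[ i ]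
          (0 < i × All (_< i) y × v ≡ x ++ y ++ z × w ≡ x ++ [ i ] ++ z)

Minimal : List ℕ → Set
Minimal w = ∀ v → ¬ (v ⊏ w)

InZeroStar : List ℕ → Set
InZeroStar w = All (_≡ 0) w

-- A step v ⊏ a ++ b replaces one letter of a ++ b, and that letter lies either in a or
-- in b; so the step is a step inside one of the two halves. Hence accessibility is
-- closed under concatenation, and well-foundedness reduces to singletons [ i ]. These
-- go by induction on i: everything directly below [ i ] is a list of letters < i.
module Submission where

open import Defs
open import Data.Empty using (⊥-elim)
open import Data.Nat using (ℕ; zero; suc; _<_; z<s)
open import Data.Nat.Properties using (<-irrefl)
open import Data.Nat.Induction using (<-wellFounded)
open import Data.List using (List; []; _∷_; _++_; [_])
open import Data.List.Properties using (++-assoc; ++-identityʳ; ∷-injective)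
open import Data.List.Relation.Unary.All as All using (All; []; _∷_)
open import Data.List.Relation.Unary.All.Properties using (++⁻ʳ)
open import Data.Product using (_,_; ∃-syntax; _×_)
open import Data.Sum using (_⊎_; inj₁; inj₂)
open import Function.Bundles using (_⇔_; mk⇔)
open import Induction.WellFounded using (WellFounded; Acc; acc)
open import Relation.Binary.PropositionalEquality using (_≡_; _≢_; refl; sym; cong; subst)
open import Relation.Binary.PropositionalEquality.Properties using (module ≡-Reasoning)

++-∷-split : ∀ {A : Set} (a : List A) {b x z i} → x ++ i ∷ z ≡ a ++ b →
  (∃[ x' ] (a ≡ x ++ i ∷ x' × z ≡ x' ++ b)) ⊎ (∃[ x' ] (b ≡ x' ++ i ∷ z × x ≡ a ++ x'))
++-∷-split []      {x = x}     eq = inj₂ (x , sym eq , refl)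
++-∷-split (_ ∷ a) {x = []}    eq with ∷-injective eq
... | refl , z≡a++b = inj₁ (a , refl , z≡a++b)
++-∷-split (_ ∷ a) {x = d ∷ x} eq with ∷-injective eq
... | refl , eq′ with ++-∷-split a {x = x} eq′
... | inj₁ (x' , a≡ , z≡) = inj₁ (x' , cong (d ∷_) a≡ , z≡)
... | inj₂ (x' , b≡ , x≡) = inj₂ (x' , b≡ , cong (d ∷_) x≡)

StepInside : List ℕ → List ℕ → List ℕ → Set
StepInside a b v = (∃[ a' ] (a' ⊏ a × v ≡ a' ++ b)) ⊎ (∃[ b' ] (b' ⊏ b × v ≡ a ++ b'))

⊏-++⁻ : ∀ a b {v} → v ⊏ (a ++ b) → StepInside a b v
⊏-++⁻ a b (x , y , z , i , 0<i , y<i , refl , w≡) with ++-∷-split a (sym w≡)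
... | inj₁ (x' , a≡ , refl) =
  inj₁ (x ++ y ++ x' , (x , y , x' , i , 0<i , y<i , refl , a≡) , v≡)
  where
  open ≡-Reasoning
  v≡ : x ++ y ++ x' ++ b ≡ (x ++ y ++ x') ++ b
  v≡ = begin
    x ++ y ++ x' ++ b     ≡⟨ cong (x ++_) (sym (++-assoc y x' b)) ⟩
    x ++ (y ++ x') ++ b   ≡⟨ sym (++-assoc x (y ++ x') b) ⟩
    (x ++ y ++ x') ++ b   ∎
... | inj₂ (x' , b≡ , refl) =
  inj₂ (x' ++ y ++ z , (x' , y , z , i , 0<i , y<i , refl , b≡) , ++-assoc a x' (y ++ z))

acc-++ : ∀ {a b} → Acc _⊏_ a → Acc _⊏_ b → Acc _⊏_ (a ++ b)
acc-++ {a} {b} (acc rs-a) (acc rs-b) = acc λ v⊏ab → below (⊏-++⁻ a b v⊏ab)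
  where
  below : ∀ {v} → StepInside a b v → Acc _⊏_ v
  below (inj₁ (a' , a'⊏a , refl)) = acc-++ (rs-a a'⊏a) (acc rs-b)
  below (inj₂ (b' , b'⊏b , refl)) = acc-++ (acc rs-a) (rs-b b'⊏b)

[]-minimal : Minimal []
[]-minimal v (x , y , z , i , _ , _ , _ , []≡) = nonempty x []≡
  where
  nonempty : ∀ x → [] ≢ x ++ i ∷ z
  nonempty [] ()
  nonempty (_ ∷ _) ()

acc-[] : Acc _⊏_ []
acc-[] = acc λ {v} v⊏[] → ⊥-elim ([]-minimal v v⊏[])

acc-All : ∀ {y} → All (λ j → Acc _⊏_ [ j ]) y → Acc _⊏_ y
acc-All []           = acc-[]
acc-All (acc-j ∷ ps) = acc-++ acc-j (acc-All ps)

⊏-[_]⁻ : ∀ i {v} → v ⊏ [ i ] → All (_< i) v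
⊏-[ i ]⁻ ([] , y , [] , .i , _ , y<i , refl , refl) =
  subst (All (_< i)) (sym (++-identityʳ y)) y<i
⊏-[ i ]⁻ ([] , _ , _ ∷ _ , _ , _ , _ , _ , ())
⊏-[ i ]⁻ (_ ∷ [] , _ , _ , _ , _ , _ , _ , ())
⊏-[ i ]⁻ (_ ∷ _ ∷ _ , _ , _ , _ , _ , _ , _ , ())

acc-[_] : ∀ i → Acc _<_ i → Acc _⊏_ [ i ]
acc-[ i ] (acc rs) = acc λ v⊏[i] →
  acc-All (All.map (λ j<i → acc-[ _ ] (rs j<i)) (⊏-[ i ]⁻ v⊏[i]))

⊏-wellFounded : WellFounded _⊏_
⊏-wellFounded []      = acc-[]
⊏-wellFounded (i ∷ w) = acc-++ (acc-[ i ] (<-wellFounded i)) (⊏-wellFounded w)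

⊏-∷⁺ : ∀ a {v w} → v ⊏ w → (a ∷ v) ⊏ (a ∷ w)
⊏-∷⁺ a (x , y , z , i , 0<i , y<i , v≡ , w≡) =
  a ∷ x , y , z , i , 0<i , y<i , cong (a ∷_) v≡ , cong (a ∷_) w≡

⊏-suc∷ : ∀ k w → w ⊏ (suc k ∷ w)
⊏-suc∷ k w = [] , [] , w , suc k , z<s , [] , refl , refl

minimal⇒InZeroStar : ∀ w → Minimal w → InZeroStar w
minimal⇒InZeroStar []          _   = []
minimal⇒InZeroStar (zero ∷ w)  min =
  refl ∷ minimal⇒InZeroStar w (λ v v⊏w → min (0 ∷ v) (⊏-∷⁺ 0 v⊏w))
minimal⇒InZeroStar (suc k ∷ w) min = ⊥-elim (min w (⊏-suc∷ k w))

InZeroStar⇒minimal : ∀ w → InZeroStar w → Minimal w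
InZeroStar⇒minimal w w≡0 v (x , y , z , i , 0<i , _ , _ , refl) with ++⁻ʳ x w≡0
... | refl ∷ _ = <-irrefl refl 0<i

lemma27 : WellFounded _⊏_ × (∀ (w : List ℕ) → Minimal w ⇔ InZeroStar w)
lemma27 = ⊏-wellFounded , λ w → mk⇔ (minimal⇒InZeroStar w) (InZeroStar⇒minimal w)
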